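{- Let $I_{MR}$ be an instance of MIN-REP with inputs $G=(X,Y,E)$, $\mathcal{P}_X$, $\mathcal{P}_Y$, let $I_D$ be the instance of the 1-DR-2 problem whose input graph is the graph $G'$ constructed from it as described in the context, and let $H$ be the set of the four hubs of $G'$. If $S$ is a feasible solution of $I_{MR}$, then $S\cup H$ is a feasible solution of $I_D$.
   Context: MIN-REP problem: input a bipartite graph $G=(X,Y,E)$, a partition $\mathcal{P}_X=\{X_1,\dots,X_{k_X}\}$ of $X$ into sets of size $|X|/k_X$, and a partition $\mathcal{P}_Y=\{Y_1,\dots,Y_{k_Y}\}$ of $Y$ into sets of size $|Y|/k_Y$. $X_i$ and $Y_j$ form a super edge if some vertex of $X_i$ is adjacent in $G$ to some vertex of $Y_j$. A feasible solution is a set $S\subseteq X\cup Y$ such that for every super edge $(X_i,Y_j)$ there are $x\in S\cap X_i$ and $y\in S\cap Y_j$ with $(x,y)\in E$; the goal is to minimize $|S|$. Construction of $G'$: start with $G$. For each $X_i$ add two vertices $px^1_i,px^2_i$ and edges $(x,px^1_i),(x,px^2_i)$ for every $x\in X_i$; for each $Y_j$ add two vertices $py^1_j,py^2_j$ and edges $(y,py^1_j),(y,py^2_j)$ for every $y\in Y_j$. For each super edge $(X_i,Y_j)$ add two vertices (relays) $r^1_{i,j},r^2_{i,j}$ and edges $(px^1_i,r^1_{i,j}),(r^1_{i,j},py^1_j),(px^2_i,r^2_{i,j}),(r^2_{i,j},py^2_j)$. Let $PX$ be the set of all $px^I_i$, $PY$ the set of all $py^I_j$, $R$ the set of relays. Add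 four hubs $h_{X,R},h_{Y,R},h_{PX},h_{PY}$ (the set $H$): $h_{X,R}$ is adjacent to every vertex of $X\cup R$, $h_{Y,R}$ to every vertex of $Y\cup R$, $h_{PX}$ to every vertex of $PX$, $h_{PY}$ to every vertex of $PY$, and the hubs form the 4-cycle $(h_{PX},h_{Y,R},h_{PY},h_{X,R},h_{PX})$. Finally, for each hub $h$ add two new vertices (dummy nodes) $d_1,d_2$ and edges $(h,d_1),(h,d_2)$. 1-DR-2 problem: for vertices $u,v$ of a graph $G'$, $m_{G'}(u,v)$ is the number of internal vertices on a shortest $u$–$v$ path ($\infty$ if none); for $D\subseteq V(G')$, $m^D(u,v)=m_{G'[D\cup\{u,v\}]}(u,v)$. Vertices $u,v$ form a target couple if $m_{G'}(u,v)=1$; $D$ covers it if $m^D(u,v)\le 2$. A feasible solution is a dominating set $D$ of $G'$ covering all target couples; the goal is to minimize $|D|$. -}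

module Defs where

open import Data.Nat using (ℕ; zero; suc; _≤_; _<_)
open import Data.Fin using (Fin)
open import Data.Product using (Σ; ∃; ∃-syntax; _×_; _,_)
open import Data.Sum using (_⊎_)
open import Data.Unit using (⊤)
open import Data.Empty using (⊥)
open import Relation.Nullary using (¬_)
open import Relation.Binary.PropositionalEquality using (_≡_; _≢_)

-- MIN-REP instances.
-- X is partitioned into kX classes of equal size sX: X = Fin kX × Fin sX,
-- class X_i = { (i , s) | s : Fin sX }.  Similarly Y = Fin kY × Fin sY.

record MinRep : Set₁ where
  field
    kX sX kY sY : ℕ
    E : (Fin kX × Fin sX) → (Fin kY × Fin sY) → Set

module _ (I : MinRep) where
  open MinRep I

  XV : Set
  XV = Fin kX × Fin sX

  YV : Set
  YV = Fin kY × Fin sY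

  SuperEdge : Fin kX → Fin kY → Set
  SuperEdge i j = ∃[ s ] ∃[ t ] E (i , s) (j , t)

  record Sol : Set₁ where
    field
      SX : XV → Set
      SY : YV → Set

  FeasibleMR : Sol → Set
  FeasibleMR S = ∀ i j → SuperEdge i j →
    ∃[ s ] ∃[ t ] (Sol.SX S (i , s) × Sol.SY S (j , t) × E (i , s) (j , t))

  -- The graph G'.  Vertices are drawn from the type V; relays r^I_{i,j}
  -- exist in G' only when (X_i , Y_j) is a super edge (predicate InG').

  data Hub : Set where
    hXR hYR hPX hPY : Hub

  data V : Set where
    xv    : Fin kX → Fin sX → V
    yv    : Fin kY → Fin sY → V
    pxv   : Fin kX → Fin 2 → V
    pyv   : Fin kY → Fin 2 → V
    relay : Fin kX → Fin kY → Fin 2 → V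
    hub   : Hub → V
    dummy : Hub → Fin 2 → V

  InG' : V → Set
  InG' (relay i j _) = SuperEdge i j
  InG' _             = ⊤

  -- directed version of the edge set; the graph is its symmetric closure
  data Arc : V → V → Set where
    eG    : ∀ {i s j t} → E (i , s) (j , t) → Arc (xv i s) (yv j t)
    x-px  : ∀ {i s I} → Arc (xv i s) (pxv i I)
    y-py  : ∀ {j t I} → Arc (yv j t) (pyv j I)
    px-r  : ∀ {i j I} → Arc (pxv i I) (relay i j I)
    r-py  : ∀ {i j I} → Arc (relay i j I) (pyv j I)
    hXR-x : ∀ {i s} → Arc (hub hXR) (xv i s)
    hXR-r : ∀ {i j I} → Arc (hub hXR) (relay i j I)
    hYR-y : ∀ {j t} → Arc (hub hYR) (yv j t)
    hYR-r : ∀ {i j I} → Arc (hub hYR) (relay i j I)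
    hPX-px : ∀ {i I} → Arc (hub hPX) (pxv i I)
    hPY-py : ∀ {j I} → Arc (hub hPY) (pyv j I)
    c1    : Arc (hub hPX) (hub hYR)
    c2    : Arc (hub hYR) (hub hPY)
    c3    : Arc (hub hPY) (hub hXR)
    c4    : Arc (hub hXR) (hub hPX)
    h-d   : ∀ {h k} → Arc (hub h) (dummy h k)

  Adj : V → V → Set
  Adj u v = Arc u v ⊎ Arc v u

  -- Walk W u v k : a walk from u to v in G' with exactly k internal
  -- vertices, all of them satisfying W (and lying in G').
  data Walk (W : V → Set) : V → V → ℕ → Set where
    direct : ∀ {u v} → Adj u v → Walk W u v 0
    step   : ∀ {u w v k} → InG' w → W w → Adj u w → Walk W w v k →
             Walk W u v (suc k)

  DistLe : (V → Set) → V → V → ℕ → Set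
  DistLe W u v k = ∃[ j ] (j ≤ k × Walk W u v j)

  DistEq : (V → Set) → V → V → ℕ → Set
  DistEq W u v k = Walk W u v k × (∀ j → j < k → ¬ Walk W u v j)

  AllV : V → Set
  AllV _ = ⊤

  TargetCouple : V → V → Set
  TargetCouple u v = InG' u × InG' v × u ≢ v × DistEq AllV u v 1

  -- m^D(u,v) = m_{G'[D ∪ {u,v}]}(u,v)
  InDuv : (V → Set) → V → V → V → Set
  InDuv D u v w = D w ⊎ (w ≡ u ⊎ w ≡ v)

  Covers : (V → Set) → V → V → Set
  Covers D u v = DistLe (InDuv D u v) u v 2

  Dominating : (V → Set) → Set
  Dominating D = ∀ v → InG' v → D v ⊎ ∃[ u ] (InG' u × D u × Adj u v)

  Feasible1DR2 : (V → Set) → Set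
  Feasible1DR2 D =
    (∀ v → D v → InG' v) ×
    Dominating D ×
    (∀ u v → TargetCouple u v → Covers D u v)

  SunionH : Sol → V → Set
  SunionH S (xv i s) = Sol.SX S (i , s)
  SunionH S (yv j t) = Sol.SY S (j , t)
  SunionH S (hub _)  = ⊤
  SunionH S _        = ⊥

-- Every vertex of G' that is not a hub has a "home" hub adjacent to
-- it, and any two hubs of the 4-cycle are equal, adjacent, or opposite with
-- a common hub neighbour.  Hence any set D containing the four hubs is
-- dominating, and it covers a target couple u – w – v by a walk through at
-- most two hubs, unless the homes of u and v are opposite.  Inspecting the
-- common neighbour w, opposite homes force either a relay endpoint (which
-- also sees the second hub of its pair) or the pattern px^J_i – r^J_{i,j} –
-- py^J_j.  The latter couple is exactly where MIN-REP feasibility enters: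
-- S contains adjacent representatives x ∈ X_i, y ∈ Y_j, giving the walk
-- px^J_i – x – y – py^J_j.
module Submission where

open import Defs
open import Data.Nat using (suc; z≤n; s≤s)
open import Data.Product using (∃-syntax; _×_; _,_)
open import Data.Sum using (_⊎_; inj₁; inj₂; swap; map₂)
open import Data.Unit using (tt)
open import Data.Empty using (⊥-elim)
open import Function using (_∘_)
open import Relation.Binary.PropositionalEquality using (_≡_; _≢_; refl; sym)

module _ {I : MinRep} where

  -- Walks can be weakened in their internal-vertex predicate and reversed;
  -- this gives the symmetry of covering, used to halve the case analysis.
  mapWalk : ∀ {W W' : V I → Set} {u v k} → (∀ w → W w → W' w) →
            Walk I W u v k → Walk I W' u v k
  mapWalk f (direct a)     = direct a
  mapWalk f (step g p a r) = step g (f _ p) a (mapWalk f r)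

  snoc : ∀ {W u w v k} → Walk I W u w k → InG' I w → W w → Adj I w v →
         Walk I W u v (suc k)
  snoc (direct a)       g p b = step g p a (direct b)
  snoc (step g' p' a r) g p b = step g' p' a (snoc r g p b)

  reverse : ∀ {W u v k} → Walk I W u v k → Walk I W v u k
  reverse (direct a)     = direct (swap a)
  reverse (step g p a r) = snoc (reverse r) g p (swap a)

  covers-sym : ∀ {D u v} → Covers I D u v → Covers I D v u
  covers-sym (k , k≤2 , r) = k , k≤2 , reverse (mapWalk (λ _ → map₂ swap) r)

  data Opposite : Hub I → Hub I → Set where
    XR-YR : Opposite hXR hYR
    YR-XR : Opposite hYR hXR
    PX-PY : Opposite hPX hPY
    PY-PX : Opposite hPY hPX

  hubTrichotomy : ∀ a b → a ≡ b ⊎ Adj I (hub a) (hub b) ⊎ Opposite a b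
  hubTrichotomy hXR hXR = inj₁ refl
  hubTrichotomy hXR hYR = inj₂ (inj₂ XR-YR)
  hubTrichotomy hXR hPX = inj₂ (inj₁ (inj₁ c4))
  hubTrichotomy hXR hPY = inj₂ (inj₁ (inj₂ c3))
  hubTrichotomy hYR hXR = inj₂ (inj₂ YR-XR)
  hubTrichotomy hYR hYR = inj₁ refl
  hubTrichotomy hYR hPX = inj₂ (inj₁ (inj₂ c1))
  hubTrichotomy hYR hPY = inj₂ (inj₁ (inj₁ c2))
  hubTrichotomy hPX hXR = inj₂ (inj₁ (inj₂ c4))
  hubTrichotomy hPX hYR = inj₂ (inj₁ (inj₁ c1))
  hubTrichotomy hPX hPX = inj₁ refl
  hubTrichotomy hPX hPY = inj₂ (inj₂ PX-PY)
  hubTrichotomy hPY hXR = inj₂ (inj₁ (inj₁ c3))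
  hubTrichotomy hPY hYR = inj₂ (inj₁ (inj₂ c2))
  hubTrichotomy hPY hPX = inj₂ (inj₂ PY-PX)
  hubTrichotomy hPY hPY = inj₁ refl

  oppositeBridge : ∀ {a b} → Opposite a b →
                   ∃[ c ] (Adj I (hub a) (hub c) × Adj I (hub c) (hub b))
  oppositeBridge XR-YR = hPX , inj₁ c4 , inj₁ c1
  oppositeBridge YR-XR = hPX , inj₂ c1 , inj₂ c4
  oppositeBridge PX-PY = hYR , inj₁ c1 , inj₁ c2
  oppositeBridge PY-PX = hYR , inj₂ c2 , inj₂ c1

  data Home : V I → Hub I → Set where
    x-home     : ∀ {i s}   → Home (xv i s) hXR
    y-home     : ∀ {j t}   → Home (yv j t) hYR
    px-home    : ∀ {i J}   → Home (pxv i J) hPX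
    py-home    : ∀ {j J}   → Home (pyv j J) hPY
    relay-home : ∀ {i j J} → Home (relay i j J) hXR
    dummy-home : ∀ {h k}   → Home (dummy h k) h

  home-adj : ∀ {v h} → Home v h → Adj I (hub h) v
  home-adj x-home     = inj₁ hXR-x
  home-adj y-home     = inj₁ hYR-y
  home-adj px-home    = inj₁ hPX-px
  home-adj py-home    = inj₁ hPY-py
  home-adj relay-home = inj₁ hXR-r
  home-adj dummy-home = inj₁ h-d

  hubOrHome : ∀ v → (∃[ h ] v ≡ hub h) ⊎ (∃[ h ] Home v h)
  hubOrHome (xv _ _)      = inj₂ (_ , x-home)
  hubOrHome (yv _ _)      = inj₂ (_ , y-home)
  hubOrHome (pxv _ _)     = inj₂ (_ , px-home)
  hubOrHome (pyv _ _)     = inj₂ (_ , py-home)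
  hubOrHome (relay _ _ _) = inj₂ (_ , relay-home)
  hubOrHome (hub h)       = inj₁ (h , refl)
  hubOrHome (dummy _ _)   = inj₂ (_ , dummy-home)

  module WithHubs (D : V I → Set) (hubsIn : ∀ h → D (hub h)) where

    oneHub : ∀ {u v h} → Adj I u (hub h) → Adj I (hub h) v → Covers I D u v
    oneHub a b = 1 , s≤s z≤n , step tt (inj₁ (hubsIn _)) a (direct b)

    twoHubs : ∀ {u v h h'} → Adj I u (hub h) → Adj I (hub h) (hub h') →
              Adj I (hub h') v → Covers I D u v
    twoHubs a b c =
      2 , s≤s (s≤s z≤n) ,
      step tt (inj₁ (hubsIn _)) a (step tt (inj₁ (hubsIn _)) b (direct c))

    -- A hub forms a covered couple with every other vertex: go through the
    -- hub cycle to the other vertex's home (or to the other hub itself).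
    hubEndpoint : ∀ h v → v ≢ hub h → Covers I D (hub h) v
    hubEndpoint h v v≢h with hubOrHome v
    ... | inj₁ (b , refl) with hubTrichotomy h b
    ...   | inj₁ refl        = ⊥-elim (v≢h refl)
    ...   | inj₂ (inj₁ hb)   = 0 , z≤n , direct hb
    ...   | inj₂ (inj₂ opp)  = let (c , hc , cb) = oppositeBridge opp in oneHub hc cb
    hubEndpoint h v v≢h | inj₂ (b , home) with hubTrichotomy h b
    ...   | inj₁ refl        = 0 , z≤n , direct (home-adj home)
    ...   | inj₂ (inj₁ hb)   = oneHub hb (home-adj home)
    ...   | inj₂ (inj₂ opp)  = let (c , hc , cb) = oppositeBridge opp in
                               twoHubs hc cb (home-adj home)

    -- Homes h_XR / h_YR with a common neighbour: u must be a relay, which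
    -- also sees h_YR (x-vertices and h_XR's dummies share no neighbour with v).
    xrYR : ∀ {u w v} → Home u hXR → Home v hYR → Adj I u w → Adj I w v →
           Covers I D u v
    xrYR relay-home home _ _ = oneHub (inj₂ hYR-r) (home-adj home)
    xrYR x-home       y-home     (inj₁ (eG _))  (inj₁ ())
    xrYR x-home       y-home     (inj₁ (eG _))  (inj₂ ())
    xrYR x-home       y-home     (inj₁ x-px)    (inj₁ ())
    xrYR x-home       y-home     (inj₁ x-px)    (inj₂ ())
    xrYR x-home       y-home     (inj₂ hXR-x)   (inj₁ ())
    xrYR x-home       y-home     (inj₂ hXR-x)   (inj₂ ())
    xrYR dummy-home   y-home     (inj₂ h-d)     (inj₁ ())
    xrYR dummy-home   y-home     (inj₂ h-d)     (inj₂ ())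
    xrYR dummy-home   dummy-home (inj₂ h-d)     (inj₁ ())
    xrYR dummy-home   dummy-home (inj₂ h-d)     (inj₂ ())

    -- The couples px^J_i – r^J_{i,j} – py^J_j: the only ones hubs cannot cover.
    RelayCouplesCovered : Set
    RelayCouplesCovered =
      ∀ {i j J} → SuperEdge I i j → Covers I D (pxv i J) (pyv j J)

    -- Homes h_PX / h_PY with a common neighbour w of G': w is the relay of a
    -- super edge between px^J_i and py^J_j.
    pxPY : RelayCouplesCovered → ∀ {u w v} → Home u hPX → Home v hPY →
           InG' I w → Adj I u w → Adj I w v → Covers I D u v
    pxPY relayCovered px-home py-home se (inj₁ px-r) (inj₁ r-py) = relayCovered se
    pxPY _ px-home    py-home    _ (inj₁ px-r)   (inj₂ ())
    pxPY _ px-home    py-home    _ (inj₂ x-px)   (inj₁ ())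
    pxPY _ px-home    py-home    _ (inj₂ x-px)   (inj₂ ())
    pxPY _ px-home    py-home    _ (inj₂ hPX-px) (inj₁ ())
    pxPY _ px-home    py-home    _ (inj₂ hPX-px) (inj₂ ())
    pxPY _ dummy-home py-home    _ (inj₂ h-d)    (inj₁ ())
    pxPY _ dummy-home py-home    _ (inj₂ h-d)    (inj₂ ())

    coversTargets : RelayCouplesCovered →
                    ∀ u v → TargetCouple I u v → Covers I D u v
    coversTargets relayCovered u v (_ , _ , u≢v , step inG _ a (direct b) , _)
      with hubOrHome u | hubOrHome v
    ... | inj₁ (h , refl) | _               = hubEndpoint h v (u≢v ∘ sym)
    ... | inj₂ _          | inj₁ (h , refl) = covers-sym (hubEndpoint h u u≢v)
    ... | inj₂ (p , hp)   | inj₂ (q , hq)   with hubTrichotomy p q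
    ...   | inj₁ refl           = oneHub (swap (home-adj hp)) (home-adj hq)
    ...   | inj₂ (inj₁ pq)      = twoHubs (swap (home-adj hp)) pq (home-adj hq)
    ...   | inj₂ (inj₂ XR-YR)   = xrYR hp hq a b
    ...   | inj₂ (inj₂ YR-XR)   = covers-sym (xrYR hq hp (swap b) (swap a))
    ...   | inj₂ (inj₂ PX-PY)   = pxPY relayCovered hp hq inG a b
    ...   | inj₂ (inj₂ PY-PX)   = covers-sym (pxPY relayCovered hq hp inG (swap b) (swap a))

    dominating : Dominating I D
    dominating v _ with hubOrHome v
    ... | inj₁ (h , refl) = inj₁ (hubsIn h)
    ... | inj₂ (h , home) = inj₂ (hub h , tt , hubsIn h , home-adj home)

  -- MIN-REP feasibility covers the relay couples: if (X_i , Y_j) is a super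
  -- edge, S holds adjacent x ∈ X_i, y ∈ Y_j and px^J_i – x – y – py^J_j is a walk.
  representativesCover : ∀ (S : Sol I) → FeasibleMR I S →
                         WithHubs.RelayCouplesCovered (SunionH I S) (λ _ → tt)
  representativesCover S feasible {i} {j} se with feasible i j se
  ... | s , t , xs , yt , e =
    2 , s≤s (s≤s z≤n) ,
    step tt (inj₁ xs) (inj₂ x-px) (step tt (inj₁ yt) (inj₁ (eG e)) (direct (inj₁ y-py)))

  sunionH-inG' : ∀ (S : Sol I) v → SunionH I S v → InG' I v
  sunionH-inG' S (xv _ _) _ = tt
  sunionH-inG' S (yv _ _) _ = tt
  sunionH-inG' S (hub _)  _ = tt

claim2 : (I : MinRep) (S : Sol I) → FeasibleMR I S → Feasible1DR2 I (SunionH I S)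
claim2 I S feasible =
  sunionH-inG' S , dominating , coversTargets (representativesCover S feasible)
  where open WithHubs (SunionH I S) (λ _ → tt)
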